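{- Let $k\geq 1$ be an integer. For each integer $l\geq 0$ let $p_l(z)=\sum_{p=0}^l \mathrm{w}(l,p)z^p$ be a real polynomial of degree at most $l$. Suppose that for all integers $l\geq p\geq 1$, $$\sum_{r=0}^{l-p}\binom{2l}{r}\mathrm{w}(l-r,p)\geq 0 .$$ Then for all integers $M,N\geq 0$: (i) if $|M-N|\leq k$, then $\sum_{l\in\mathbb{Z}}\binom{M+N}{M-kl}^2 p_{|l|}(z)=\sum_{p\geq 0}b_p z^p$ with $b_p\geq 0$ for all $p>0$; (ii) $\sum_{l\in\mathbb{Z}}\binom{M+N}{M-kl}\binom{M+N}{N-kl} p_{|l|}(z)=\sum_{p\geq 0}c_p z^p$ with $c_p\geq 0$ for all $p>0$.
   Context: Binomial coefficients $\binom{n}{j}$ are $0$ when $j<0$ or $j>n$, so the sums over $l$ are finite and define polynomials in $z$. -}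

module Defs where

open import Level using (Level; _⊔_)
open import Data.Nat as ℕ using (ℕ; zero; suc; _≤ᵇ_)
open import Data.Nat.Combinatorics using (_C_)
open import Data.Integer as ℤ using (ℤ; +_; -[1+_]; ∣_∣)
open import Data.Bool using (if_then_else_)
open import Algebra.Bundles using (CommutativeRing)
open import Relation.Binary.Core using (Rel)
open import Relation.Binary.Structures using (IsTotalOrder)

-- An ordered commutative ring (e.g. the real numbers ℝ): a commutative ring
-- with a total order compatible with addition and with multiplication of
-- nonnegative elements.
record OrderedCommutativeRing (c ℓ₁ ℓ₂ : Level) : Set (Level.suc (c ⊔ ℓ₁ ⊔ ℓ₂)) where
  field
    commutativeRing : CommutativeRing c ℓ₁
  open CommutativeRing commutativeRing public
  field
    _≤_          : Rel Carrier ℓ₂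
    isTotalOrder : IsTotalOrder _≈_ _≤_
    +-mono-≤     : ∀ {x y} z → x ≤ y → (x + z) ≤ (y + z)
    *-nonneg     : ∀ {x y} → 0# ≤ x → 0# ≤ y → 0# ≤ (x * y)

module _ {c ℓ₁ ℓ₂} (R : OrderedCommutativeRing c ℓ₁ ℓ₂) where
  open OrderedCommutativeRing R

  _·_ : ℕ → Carrier → Carrier
  zero  · x = 0#
  suc n · x = x + (n · x)

  sumTo : ℕ → (ℕ → Carrier) → Carrier
  sumTo zero    f = 0#
  sumTo (suc n) f = sumTo n f + f n

  sumSym : ℕ → (ℤ → Carrier) → Carrier
  sumSym L f = sumTo (suc (2 ℕ.* L)) (λ i → f (+ i ℤ.- + L))

  -- coefficient of z^p in p_l(z) = Σ_{p=0}^{l} w(l,p) z^p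
  polyCoeff : (ℕ → ℕ → Carrier) → ℕ → ℕ → Carrier
  polyCoeff w l p = if p ≤ᵇ l then w l p else 0#

  Hyp : (ℕ → ℕ → Carrier) → Set ℓ₂
  Hyp w = ∀ l p → 1 ℕ.≤ p → p ℕ.≤ l →
    0# ≤ sumTo (suc (l ℕ.∸ p)) (λ r → ((2 ℕ.* l) C r) · w (l ℕ.∸ r) p)

  -- coefficient of z^p in Σ_{l∈ℤ} a(l) p_{|l|}(z), where a(l) = 0 for |l| > L
  seriesCoeff : (ℕ → ℕ → Carrier) → ℕ → (ℤ → ℕ) → ℕ → Carrier
  seriesCoeff w L a p = sumSym L (λ l → a l · polyCoeff w ∣ l ∣ p)

-- binomial coefficient with integer lower index: C(n,j) = 0 for j < 0 (and j > n)
binomℤ : ℕ → ℤ → ℕ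
binomℤ n (+ j)    = n C j
binomℤ n -[1+ _ ] = 0

distℕ : ℕ → ℕ → ℕ
distℕ M N = ∣ + M ℤ.- + N ∣

module Submission where

-- For finitely
-- supported a : ℤ → ℕ the z^p-coefficient of Σ_l a(l) p_{|l|}(z) equals
-- Φ(a(l) + a(-l)) with Φ g = Σ_{j≥1} g(j) w(j,p).  On the Pascal rows
-- l ↦ C(2m, m+l), Φ is exactly the sum of the hypothesis, so Φ ≥ 0 on the cone
-- these rows span over ℕ.  It remains to show that both coefficient sequences
-- have symmetrisations in this cone:
--   1. binomials count ±1 walks, and a product of two walk counts counts walks
--      in ℤ² with steps (±1,0), (0,±1); separating horizontal and vertical steps
--      gives Σ_i C(n,i) walks_{n-i}(v) · walks_i(δ - 2kl) with |δ| ≤ k;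
--   2. walks to the lattice 2kℤ, and the pairs walks_s(δ ∓ 2kl) with |δ| ≤ k,
--      lie in the cone: decompose a walk at its last visit to 2kℤ and compare
--      the excursions inside the strip by a reflection inequality.

open import Defs
open import Level using (Level)
open import Data.Nat using (ℕ; _≤_; _+_; _*_)
open import Data.Integer using (ℤ; +_; _-_)
open import Data.Product using (_×_)
open Defs.OrderedCommutativeRing using (0#) renaming (_≤_ to _≤R_)

open import Data.Nat as ℕ using (zero; suc; _<_; _∸_; z≤n; s≤s)
import Data.Nat.Properties as ℕP
open import Data.Nat.Combinatorics
  using (_C_; nCk+nC[k+1]≡[n+1]C[k+1]; k>n⇒nCk≡0; nCk≡nC[n∸k])
open import Data.Nat.Induction using (<-rec)
open import Data.Nat.Tactic.RingSolver renaming (solve-∀ to ℕ-solve)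
open import Data.Integer as ℤ using (-[1+_]; ∣_∣)
import Data.Integer.Properties as ℤP
open import Data.Integer.Tactic.RingSolver renaming (solve-∀ to ℤ-solve)
open import Data.Product using (_,_)
open import Data.Sum using (inj₁; inj₂; _⊎_)
open import Data.Empty using (⊥; ⊥-elim)
open import Data.Bool using (true; false)
open import Relation.Nullary using (yes; no; ¬_)
open import Relation.Binary.PropositionalEquality
open import Relation.Binary.Structures using (IsTotalOrder)
open import Algebra.Properties.CommutativeSemigroup ℕP.+-commutativeSemigroup
  using () renaming (interchange to +-interchange)

-- Lattice walks and binomial coefficients.

-- walks s z: the number of ±1 walks of length s from 0 to z.
walks : ℕ → ℤ → ℕ
walks zero    (+ zero)  = 1
walks zero    (+ suc _) = 0
walks zero    -[1+ _ ]  = 0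
walks (suc s) z         = walks s (z - + 1) + walks s (z ℤ.+ + 1)

walks-zero-off-origin : ∀ z → z ≢ + 0 → walks 0 z ≡ 0
walks-zero-off-origin (+ zero)  z≢0 = ⊥-elim (z≢0 refl)
walks-zero-off-origin (+ suc _) _   = refl
walks-zero-off-origin -[1+ _ ]  _   = refl

walks-neg : ∀ s z → walks s (ℤ.- z) ≡ walks s z
walks-neg zero    (+ zero)  = refl
walks-neg zero    (+ suc _) = refl
walks-neg zero    -[1+ _ ]  = refl
walks-neg (suc s) z = begin
    walks s (ℤ.- z - + 1) + walks s (ℤ.- z ℤ.+ + 1)
  ≡⟨ cong₂ _+_ (cong (walks s) (neg-plus z)) (cong (walks s) (neg-minus z)) ⟩
    walks s (ℤ.- (z ℤ.+ + 1)) + walks s (ℤ.- (z - + 1))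
  ≡⟨ cong₂ _+_ (walks-neg s (z ℤ.+ + 1)) (walks-neg s (z - + 1)) ⟩
    walks s (z ℤ.+ + 1) + walks s (z - + 1)
  ≡⟨ ℕP.+-comm (walks s (z ℤ.+ + 1)) (walks s (z - + 1)) ⟩
    walks s (z - + 1) + walks s (z ℤ.+ + 1) ∎
  where
  open ≡-Reasoning
  neg-plus : ∀ z → ℤ.- z - + 1 ≡ ℤ.- (z ℤ.+ + 1)
  neg-plus = ℤ-solve
  neg-minus : ∀ z → ℤ.- z ℤ.+ + 1 ≡ ℤ.- (z - + 1)
  neg-minus = ℤ-solve

binomℤ-pascal : ∀ n j → binomℤ (suc n) j ≡ binomℤ n (j - + 1) + binomℤ n j
binomℤ-pascal n (+ zero)  = refl
binomℤ-pascal n (+ suc j) = sym (nCk+nC[k+1]≡[n+1]C[k+1] n j)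
binomℤ-pascal n -[1+ _ ]  = refl

-- C(n, j) counts the walks of length n from 0 to 2j - n (j up-steps).
binomℤ≡walks : ∀ n j → binomℤ n j ≡ walks n ((j ℤ.+ j) - + n)
binomℤ≡walks zero (+ zero)  = refl
binomℤ≡walks zero (+ suc _) = refl
binomℤ≡walks zero -[1+ _ ]  = refl
binomℤ≡walks (suc n) j = begin
    binomℤ (suc n) j
  ≡⟨ binomℤ-pascal n j ⟩
    binomℤ n (j - + 1) + binomℤ n j
  ≡⟨ cong₂ _+_ (binomℤ≡walks n (j - + 1)) (binomℤ≡walks n j) ⟩
    walks n (((j - + 1) ℤ.+ (j - + 1)) - + n) + walks n ((j ℤ.+ j) - + n)
  ≡⟨ cong₂ _+_ (cong (walks n) (down j (+ n))) (cong (walks n) (up j (+ n))) ⟩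
    walks (suc n) ((j ℤ.+ j) - + suc n) ∎
  where
  open ≡-Reasoning
  down : ∀ j m → ((j - + 1) ℤ.+ (j - + 1)) - m ≡ ((j ℤ.+ j) - (+ 1 ℤ.+ m)) - + 1
  down = ℤ-solve
  up : ∀ j m → (j ℤ.+ j) - m ≡ ((j ℤ.+ j) - (+ 1 ℤ.+ m)) ℤ.+ + 1
  up = ℤ-solve

sumℕ : ℕ → (ℕ → ℕ) → ℕ
sumℕ zero    f = 0
sumℕ (suc n) f = sumℕ n f + f n

sumℕ-shift : ∀ n f → sumℕ (suc n) f ≡ f 0 + sumℕ n (λ i → f (suc i))
sumℕ-shift zero    f = ℕP.+-comm 0 (f 0)
sumℕ-shift (suc n) f = begin
  sumℕ (suc n) f + f (suc n)                     ≡⟨ cong (_+ f (suc n)) (sumℕ-shift n f) ⟩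
  f 0 + sumℕ n (λ i → f (suc i)) + f (suc n)     ≡⟨ ℕP.+-assoc (f 0) _ _ ⟩
  f 0 + (sumℕ n (λ i → f (suc i)) + f (suc n))   ∎
  where open ≡-Reasoning

sumℕ-cong : ∀ n {f g} → (∀ i → i < n → f i ≡ g i) → sumℕ n f ≡ sumℕ n g
sumℕ-cong zero    f≡g = refl
sumℕ-cong (suc n) f≡g =
  cong₂ _+_ (sumℕ-cong n (λ i i<n → f≡g i (ℕP.m<n⇒m<1+n i<n))) (f≡g n (ℕP.n<1+n n))

sumℕ-+ : ∀ n f g → sumℕ n (λ i → f i + g i) ≡ sumℕ n f + sumℕ n g
sumℕ-+ zero    f g = refl
sumℕ-+ (suc n) f g = begin
  sumℕ n (λ i → f i + g i) + (f n + g n)   ≡⟨ cong (_+ (f n + g n)) (sumℕ-+ n f g) ⟩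
  sumℕ n f + sumℕ n g + (f n + g n)        ≡⟨ +-interchange (sumℕ n f) (sumℕ n g) (f n) (g n) ⟩
  sumℕ n f + f n + (sumℕ n g + g n)        ∎
  where open ≡-Reasoning

sumℕ-zero : ∀ n f → (∀ i → f i ≡ 0) → sumℕ n f ≡ 0
sumℕ-zero zero    f f≡0 = refl
sumℕ-zero (suc n) f f≡0 = cong₂ _+_ (sumℕ-zero n f f≡0) (f≡0 n)

-- The product formula.  walkProduct n u v counts pairs of walks of length n
-- ending at u+v and u-v, i.e. walks in ℤ² with steps (±1,±1) ending at
-- (u+v, u-v).  Rotating by 45° these become walks with steps (±1,0), (0,±1)
-- ending at (u, v), which crossWalks counts by choosing the i horizontal steps.
-- Both counts satisfy the same four-neighbour recursion, hence agree.

walkProduct : ℕ → ℤ → ℤ → ℕ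
walkProduct n u v = walks n (u ℤ.+ v) * walks n (u - v)

crossWalks : ℕ → ℤ → ℤ → ℕ
crossWalks n u v = sumℕ (suc n) (λ i → (n C i) * (walks i u * walks (n ∸ i) v))

-- Only the empty walk has length 0: both counts are 1 at (0,0) and 0 elsewhere.
walkProduct-zero : ∀ u v → walkProduct 0 u v ≡ crossWalks 0 u v
walkProduct-zero u v with u ℤ.≟ + 0 | v ℤ.≟ + 0
... | yes refl | yes refl = refl
... | yes refl | no v≢0
  rewrite ℤP.+-identityˡ v | ℤP.+-identityˡ (ℤ.- v) | walks-zero-off-origin v v≢0 = refl
... | no u≢0 | _ rewrite walks-zero-off-origin u u≢0 = product-vanishes
  where
  double : ∀ u v → u ℤ.+ u ≡ (u ℤ.+ v) ℤ.+ (u - v)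
  double = ℤ-solve
  u+u≢0 : u ℤ.+ u ≢ + 0
  u+u≢0 = halve u u≢0
    where
    halve : ∀ u → u ≢ + 0 → u ℤ.+ u ≢ + 0
    halve (+ zero)  u≢0 _ = u≢0 refl
    halve (+ suc _) _ ()
    halve -[1+ _ ]  _ ()
  product-vanishes : walkProduct 0 u v ≡ 0
  product-vanishes with (u ℤ.+ v) ℤ.≟ + 0 | (u - v) ℤ.≟ + 0
  ... | yes sum≡0 | yes diff≡0 = ⊥-elim (u+u≢0 (trans (double u v) (cong₂ ℤ._+_ sum≡0 diff≡0)))
  ... | no sum≢0  | _ rewrite walks-zero-off-origin _ sum≢0 = refl
  ... | yes _     | no diff≢0 rewrite walks-zero-off-origin _ diff≢0 = ℕP.*-zeroʳ (walks 0 (u ℤ.+ v))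

walkProduct-step : ∀ n u v → walkProduct (suc n) u v ≡
  (walkProduct n (u - + 1) v + walkProduct n (u ℤ.+ + 1) v) +
  (walkProduct n u (v - + 1) + walkProduct n u (v ℤ.+ + 1))
walkProduct-step n u v = begin
    (a + b) * (c + d)
  ≡⟨ expand a b c d ⟩
    (a * c + b * d) + (a * d + b * c)
  ≡⟨ sym (cong₂ _+_
       (cong₂ _+_ (at (u ℤ.+ down) v (shiftˡ-+ u v down) (shiftˡ-- u v down))
                  (at (u ℤ.+ up) v (shiftˡ-+ u v up) (shiftˡ-- u v up)))
       (cong₂ _+_ (at u (v ℤ.+ down) (shiftʳ-+ u v down) (shiftʳ-- u v down))
                  (at u (v ℤ.+ up) (shiftʳ-+ u v up) (shiftʳ-- u v up)))) ⟩
    (walkProduct n (u - + 1) v + walkProduct n (u ℤ.+ + 1) v) +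
    (walkProduct n u (v - + 1) + walkProduct n u (v ℤ.+ + 1)) ∎
  where
  open ≡-Reasoning
  down up : ℤ
  down = ℤ.- + 1
  up   = + 1
  a = walks n ((u ℤ.+ v) - + 1)
  b = walks n ((u ℤ.+ v) ℤ.+ + 1)
  c = walks n ((u - v) - + 1)
  d = walks n ((u - v) ℤ.+ + 1)
  expand : ∀ a b c d → (a + b) * (c + d) ≡ (a * c + b * d) + (a * d + b * c)
  expand = ℕ-solve
  at : ∀ u v {x y} → u ℤ.+ v ≡ x → u - v ≡ y → walkProduct n u v ≡ walks n x * walks n y
  at u v refl refl = refl
  shiftˡ-+ : ∀ u v e → (u ℤ.+ e) ℤ.+ v ≡ (u ℤ.+ v) ℤ.+ e
  shiftˡ-+ = ℤ-solve
  shiftˡ-- : ∀ u v e → (u ℤ.+ e) - v ≡ (u - v) ℤ.+ e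
  shiftˡ-- = ℤ-solve
  shiftʳ-+ : ∀ u v e → u ℤ.+ (v ℤ.+ e) ≡ (u ℤ.+ v) ℤ.+ e
  shiftʳ-+ = ℤ-solve
  shiftʳ-- : ∀ u v e → u - (v ℤ.+ e) ≡ (u - v) - e
  shiftʳ-- = ℤ-solve

binomialSum-pascal : ∀ n (X : ℕ → ℕ) →
  sumℕ (suc (suc n)) (λ i → (suc n C i) * X i) ≡
  sumℕ (suc n) (λ i → (n C i) * X (suc i)) + sumℕ (suc n) (λ i → (n C i) * X i)
binomialSum-pascal n X = begin
    sumℕ (suc (suc n)) (λ i → (suc n C i) * X i)
  ≡⟨ sumℕ-shift (suc n) _ ⟩
    X₀ + sumℕ (suc n) (λ i → (suc n C suc i) * X (suc i))
  ≡⟨ cong (λ t → X₀ + t) (trans (sumℕ-cong (suc n) (λ i _ → pascal i)) (sumℕ-+ (suc n) _ _)) ⟩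
    X₀ + (A + B)
  ≡⟨ swap X₀ A B ⟩
    A + (X₀ + B)
  ≡⟨ cong (λ t → A + t) (sym (sumℕ-shift (suc n) (λ i → (n C i) * X i))) ⟩
    A + sumℕ (suc (suc n)) (λ i → (n C i) * X i)
  ≡⟨ cong (λ t → A + (sumℕ (suc n) (λ i → (n C i) * X i) + t * X (suc n))) (k>n⇒nCk≡0 (ℕP.n<1+n n)) ⟩
    A + (sumℕ (suc n) (λ i → (n C i) * X i) + 0)
  ≡⟨ cong (λ t → A + t) (ℕP.+-identityʳ _) ⟩
    A + sumℕ (suc n) (λ i → (n C i) * X i) ∎
  where
  open ≡-Reasoning
  X₀ = (n C 0) * X 0
  A = sumℕ (suc n) (λ i → (n C i) * X (suc i))
  B = sumℕ (suc n) (λ i → (n C suc i) * X (suc i))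
  pascal : ∀ i → (suc n C suc i) * X (suc i) ≡ (n C i) * X (suc i) + (n C suc i) * X (suc i)
  pascal i = trans (cong (_* X (suc i)) (sym (nCk+nC[k+1]≡[n+1]C[k+1] n i)))
                   (ℕP.*-distribʳ-+ (X (suc i)) (n C i) (n C suc i))
  swap : ∀ a b c → a + (b + c) ≡ b + (a + c)
  swap = ℕ-solve

-- The four-neighbour recursion for crossWalks: the last step is horizontal
-- (first sum of binomialSum-pascal) or vertical (second sum).
crossWalks-step : ∀ n u v → crossWalks (suc n) u v ≡
  (crossWalks n (u - + 1) v + crossWalks n (u ℤ.+ + 1) v) +
  (crossWalks n u (v - + 1) + crossWalks n u (v ℤ.+ + 1))
crossWalks-step n u v = begin
    crossWalks (suc n) u v
  ≡⟨ binomialSum-pascal n (λ i → walks i u * walks (suc n ∸ i) v) ⟩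
    sumℕ (suc n) (λ i → (n C i) * (walks (suc i) u * walks (n ∸ i) v)) +
    sumℕ (suc n) (λ i → (n C i) * (walks i u * walks (suc n ∸ i) v))
  ≡⟨ cong₂ _+_ (trans (sumℕ-cong (suc n) (λ i _ → horizontal i)) (sumℕ-+ (suc n) _ _))
               (trans (sumℕ-cong (suc n) (λ i i≤n → vertical i i≤n)) (sumℕ-+ (suc n) _ _)) ⟩
    (crossWalks n (u - + 1) v + crossWalks n (u ℤ.+ + 1) v) +
    (crossWalks n u (v - + 1) + crossWalks n u (v ℤ.+ + 1)) ∎
  where
  open ≡-Reasoning
  distribˡ : ∀ c a b x → c * ((a + b) * x) ≡ c * (a * x) + c * (b * x)
  distribˡ = ℕ-solve
  distribʳ : ∀ c a b x → c * (x * (a + b)) ≡ c * (x * a) + c * (x * b)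
  distribʳ = ℕ-solve
  horizontal : ∀ i → (n C i) * (walks (suc i) u * walks (n ∸ i) v) ≡
    (n C i) * (walks i (u - + 1) * walks (n ∸ i) v) + (n C i) * (walks i (u ℤ.+ + 1) * walks (n ∸ i) v)
  horizontal i = distribˡ (n C i) (walks i (u - + 1)) (walks i (u ℤ.+ + 1)) (walks (n ∸ i) v)
  vertical : ∀ i → i < suc n → (n C i) * (walks i u * walks (suc n ∸ i) v) ≡
    (n C i) * (walks i u * walks (n ∸ i) (v - + 1)) + (n C i) * (walks i u * walks (n ∸ i) (v ℤ.+ + 1))
  vertical i i<1+n = begin
      (n C i) * (walks i u * walks (suc n ∸ i) v)
    ≡⟨ cong (λ m → (n C i) * (walks i u * walks m v)) (ℕP.+-∸-assoc 1 (ℕP.≤-pred i<1+n)) ⟩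
      (n C i) * (walks i u * walks (suc (n ∸ i)) v)
    ≡⟨ distribʳ (n C i) (walks (n ∸ i) (v - + 1)) (walks (n ∸ i) (v ℤ.+ + 1)) (walks i u) ⟩
      (n C i) * (walks i u * walks (n ∸ i) (v - + 1)) + (n C i) * (walks i u * walks (n ∸ i) (v ℤ.+ + 1)) ∎

walkProduct≡crossWalks : ∀ n u v → walkProduct n u v ≡ crossWalks n u v
walkProduct≡crossWalks zero u v = walkProduct-zero u v
walkProduct≡crossWalks (suc n) u v = begin
    walkProduct (suc n) u v
  ≡⟨ walkProduct-step n u v ⟩
    (walkProduct n (u - + 1) v + walkProduct n (u ℤ.+ + 1) v) +
    (walkProduct n u (v - + 1) + walkProduct n u (v ℤ.+ + 1))
  ≡⟨ cong₂ _+_ (cong₂ _+_ (walkProduct≡crossWalks n _ v) (walkProduct≡crossWalks n _ v))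
               (cong₂ _+_ (walkProduct≡crossWalks n u _) (walkProduct≡crossWalks n u _)) ⟩
    (crossWalks n (u - + 1) v + crossWalks n (u ℤ.+ + 1) v) +
    (crossWalks n u (v - + 1) + crossWalks n u (v ℤ.+ + 1))
  ≡⟨ sym (crossWalks-step n u v) ⟩
    crossWalks (suc n) u v ∎
  where open ≡-Reasoning

binomProduct≡crossWalks : ∀ n x y u v →
  (x ℤ.+ x) - + n ≡ u ℤ.+ v → (y ℤ.+ y) - + n ≡ u - v →
  binomℤ n x * binomℤ n y ≡ crossWalks n u v
binomProduct≡crossWalks n x y u v ex ey = begin
    binomℤ n x * binomℤ n y
  ≡⟨ cong₂ _*_ (trans (binomℤ≡walks n x) (cong (walks n) ex)) (trans (binomℤ≡walks n y) (cong (walks n) ey)) ⟩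
    walkProduct n u v
  ≡⟨ walkProduct≡crossWalks n u v ⟩
    crossWalks n u v ∎
  where open ≡-Reasoning

-- The row cone.

row : ℕ → ℤ → ℕ
row m l = binomℤ (m + m) (+ m ℤ.+ l)

-- RowCone B f: f is a linear combination, with coefficients in ℕ, of the rows
-- row m with m ≤ B.  (cone-ext makes membership a property of the function.)
data RowCone (B : ℕ) : (ℤ → ℕ) → Set where
  cone-row : ∀ m → m ≤ B → RowCone B (row m)
  cone-+   : ∀ {f g} → RowCone B f → RowCone B g → RowCone B (λ l → f l + g l)
  cone-*   : ∀ {f} c → RowCone B f → RowCone B (λ l → c * f l)
  cone-ext : ∀ {f g} → (∀ l → f l ≡ g l) → RowCone B f → RowCone B g

cone-zero : ∀ {B} → RowCone B (λ _ → 0)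
cone-zero = cone-* 0 (cone-row 0 z≤n)

cone-mono : ∀ {B B′ f} → B ≤ B′ → RowCone B f → RowCone B′ f
cone-mono B≤B′ (cone-row m m≤B) = cone-row m (ℕP.≤-trans m≤B B≤B′)
cone-mono B≤B′ (cone-+ cf cg)   = cone-+ (cone-mono B≤B′ cf) (cone-mono B≤B′ cg)
cone-mono B≤B′ (cone-* c cf)    = cone-* c (cone-mono B≤B′ cf)
cone-mono B≤B′ (cone-ext e cf)  = cone-ext e (cone-mono B≤B′ cf)

cone-sum : ∀ {B} n (F : ℕ → ℤ → ℕ) → (∀ t → t < n → RowCone B (F t)) →
  RowCone B (λ l → sumℕ n (λ t → F t l))
cone-sum zero    F cF = cone-zero
cone-sum (suc n) F cF = cone-+ (cone-sum n F (λ t t<n → cF t (ℕP.m<n⇒m<1+n t<n))) (cF n (ℕP.n<1+n n))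

-- pascalStep f l = 2 f(l) + f(l-1) + f(l+1).  Applying Pascal's rule twice
-- shows that it maps row m to row (m+1); being linear, it maps the cone up
-- by one level.
pascalStep : (ℤ → ℕ) → ℤ → ℕ
pascalStep f l = 2 * f l + (f (l - + 1) + f (l ℤ.+ + 1))

pascalStep-row : ∀ m l → row (suc m) l ≡ pascalStep (row m) l
pascalStep-row m l = begin
    binomℤ (suc m + suc m) j
  ≡⟨ cong (λ n → binomℤ n j) (cong suc (ℕP.+-suc m m)) ⟩
    binomℤ (suc (suc (m + m))) j
  ≡⟨ binomℤ-pascal (suc (m + m)) j ⟩
    binomℤ (suc (m + m)) (j - + 1) + binomℤ (suc (m + m)) j
  ≡⟨ cong₂ _+_ (binomℤ-pascal (m + m) (j - + 1)) (binomℤ-pascal (m + m) j) ⟩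
    (binomℤ (m + m) ((j - + 1) - + 1) + binomℤ (m + m) (j - + 1)) +
    (binomℤ (m + m) (j - + 1) + binomℤ (m + m) j)
  ≡⟨ cong₂ _+_ (cong₂ _+_ (cong (binomℤ (m + m)) (left (+ m) l)) (cong (binomℤ (m + m)) (centre (+ m) l)))
               (cong₂ _+_ (cong (binomℤ (m + m)) (centre (+ m) l)) (cong (binomℤ (m + m)) (right (+ m) l))) ⟩
    (row m (l - + 1) + row m l) + (row m l + row m (l ℤ.+ + 1))
  ≡⟨ regroup (row m (l - + 1)) (row m l) (row m (l ℤ.+ + 1)) ⟩
    pascalStep (row m) l ∎
  where
  open ≡-Reasoning
  j = + suc m ℤ.+ l
  left : ∀ a l → ((+ 1 ℤ.+ a) ℤ.+ l - + 1) - + 1 ≡ a ℤ.+ (l - + 1)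
  left = ℤ-solve
  centre : ∀ a l → (+ 1 ℤ.+ a) ℤ.+ l - + 1 ≡ a ℤ.+ l
  centre = ℤ-solve
  right : ∀ a l → (+ 1 ℤ.+ a) ℤ.+ l ≡ a ℤ.+ (l ℤ.+ + 1)
  right = ℤ-solve
  regroup : ∀ a b c → (a + b) + (b + c) ≡ 2 * b + (a + c)
  regroup = ℕ-solve

cone-step : ∀ {B f} → RowCone B f → RowCone (suc B) (pascalStep f)
cone-step (cone-row m m≤B) = cone-ext (pascalStep-row m) (cone-row (suc m) (s≤s m≤B))
cone-step (cone-+ {f} {g} cf cg) = cone-ext additive (cone-+ (cone-step cf) (cone-step cg))
  where
  regroup : ∀ a b c d e f → (2 * a + (c + e)) + (2 * b + (d + f)) ≡ 2 * (a + b) + ((c + d) + (e + f))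
  regroup = ℕ-solve
  additive : ∀ l → pascalStep f l + pascalStep g l ≡ pascalStep (λ l → f l + g l) l
  additive l = regroup (f l) (g l) (f (l - + 1)) (g (l - + 1)) (f (l ℤ.+ + 1)) (g (l ℤ.+ + 1))
cone-step (cone-* {f} c cf) = cone-ext homogeneous (cone-* c (cone-step cf))
  where
  distrib : ∀ c a b d → c * (2 * a + (b + d)) ≡ 2 * (c * a) + (c * b + c * d)
  distrib = ℕ-solve
  homogeneous : ∀ l → c * pascalStep f l ≡ pascalStep (λ l → c * f l) l
  homogeneous l = distrib c (f l) (f (l - + 1)) (f (l ℤ.+ + 1))
cone-step (cone-ext {f} {g} f≡g cf) = cone-ext respects (cone-step cf)
  where
  respects : ∀ l → pascalStep f l ≡ pascalStep g l
  respects l = cong₂ _+_ (cong (2 *_) (f≡g l)) (cong₂ _+_ (f≡g (l - + 1)) (f≡g (l ℤ.+ + 1)))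

symmetrize : (ℤ → ℕ) → ℤ → ℕ
symmetrize a l = a l + a (ℤ.- l)

module Strip (k′ : ℕ) where

  k K : ℕ
  k = suc k′
  K = k + k

  -- stripWalks t r: the number of walks of length t from 1 to r that stay
  -- strictly between 0 and K.
  stripWalks : ℕ → ℕ → ℕ
  stripWalks zero    (suc zero) = 1
  stripWalks zero    zero       = 0
  stripWalks zero    (suc (suc _)) = 0
  stripWalks (suc t) zero       = 0
  stripWalks (suc t) (suc r) with suc r ℕ.<? K
  ... | yes _ = stripWalks t r + stripWalks t (suc (suc r))
  ... | no  _ = 0

  stripWalks-at-0 : ∀ t → stripWalks t 0 ≡ 0
  stripWalks-at-0 zero    = refl
  stripWalks-at-0 (suc t) = refl

  stripWalks-at-K : ∀ t → stripWalks t K ≡ 0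
  stripWalks-at-K zero rewrite ℕP.+-suc k′ k′ = refl
  stripWalks-at-K (suc t) with K ℕ.<? K
  ... | yes K<K = ⊥-elim (ℕP.<-irrefl refl K<K)
  ... | no  _   = refl

  stripWalks-step : ∀ t r → suc r < K → stripWalks (suc t) (suc r) ≡ stripWalks t r + stripWalks t (suc (suc r))
  stripWalks-step t r r<K with suc r ℕ.<? K
  ... | yes _   = refl
  ... | no  r≮K = ⊥-elim (r≮K r<K)

  stripWalks-reflection : ∀ t a b → a + b ≡ K → b ≤ k → stripWalks t a ≤ stripWalks t b
  stripWalks-reflection zero zero          b _ _ = z≤n
  stripWalks-reflection zero (suc (suc a)) b _ _ = z≤n
  stripWalks-reflection zero (suc zero)    b 1+b≡K b≤k = ℕP.≤-reflexive (cong (stripWalks 0) (sym b≡1))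
    where
    b≡k′+k : b ≡ k′ + k
    b≡k′+k = ℕP.suc-injective 1+b≡K
    k′≡0 : k′ ≡ 0
    k′≡0 = ℕP.n≤0⇒n≡0 (ℕP.+-cancelʳ-≤ k k′ 0 (subst (_≤ k) b≡k′+k b≤k))
    b≡1 : b ≡ 1
    b≡1 = trans b≡k′+k (cong (λ x → x + suc x) k′≡0)
  stripWalks-reflection (suc t) a zero a+0≡K _ =
    ℕP.≤-reflexive (trans (cong (stripWalks (suc t)) (trans (sym (ℕP.+-identityʳ a)) a+0≡K)) (stripWalks-at-K (suc t)))
  stripWalks-reflection (suc t) zero (suc b) _ _ = z≤n
  stripWalks-reflection (suc t) (suc a) (suc b) e b+1≤k = begin
      stripWalks (suc t) (suc a)
    ≡⟨ stripWalks-step t a a<K ⟩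
      stripWalks t a + stripWalks t (suc (suc a))
    ≤⟨ neighbours (ℕP.m≤n⇒m<n∨m≡n b+1≤k) ⟩
      stripWalks t b + stripWalks t (suc (suc b))
    ≡⟨ stripWalks-step t b b<K ⟨
      stripWalks (suc t) (suc b) ∎
    where
    open ℕP.≤-Reasoning
    b<K : suc b < K
    b<K = ℕP.≤-trans (s≤s b+1≤k) (s≤s (ℕP.m≤n+m k k′))
    a<K : suc a < K
    a<K = subst (suc a <_) e (ℕP.m<m+n (suc a) (s≤s z≤n))
    outer : suc (suc a) + b ≡ K
    outer = trans (cong suc (sym (ℕP.+-suc a b))) e
    inner : a + suc (suc b) ≡ K
    inner = trans (ℕP.+-suc a (suc b)) e
    -- If b+1 < k both neighbours of a are mirror images of neighbours of b; if
    -- b+1 = k then a = b is the middle of the strip.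
    neighbours : suc b < k ⊎ suc b ≡ k →
      stripWalks t a + stripWalks t (suc (suc a)) ≤ stripWalks t b + stripWalks t (suc (suc b))
    neighbours (inj₁ b+1<k) = ℕP.≤-trans
      (ℕP.+-mono-≤ (stripWalks-reflection t a (suc (suc b)) inner b+1<k)
                   (stripWalks-reflection t (suc (suc a)) b outer (ℕP.≤-trans (ℕP.n≤1+n b) (ℕP.<⇒≤ b+1<k))))
      (ℕP.≤-reflexive (ℕP.+-comm (stripWalks t (suc (suc b))) (stripWalks t b)))
    neighbours (inj₂ b+1≡k) = ℕP.≤-reflexive (cong (λ x → stripWalks t x + stripWalks t (suc (suc x))) a≡b)
      where
      a≡b : a ≡ b
      a≡b = ℕP.+-cancelʳ-≡ (suc (suc b)) a b
              (trans inner (trans (cong (λ x → x + x) (sym b+1≡k)) (sym (ℕP.+-suc b (suc b)))))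

  point : ℤ → ℕ → ℤ
  point l r = + K ℤ.* l ℤ.+ + r

  point-pred : ∀ l r → point l (suc r) - + 1 ≡ point l r
  point-pred l r = shift (+ K) l (+ r)
    where
    shift : ∀ a l r → a ℤ.* l ℤ.+ (+ 1 ℤ.+ r) - + 1 ≡ a ℤ.* l ℤ.+ r
    shift = ℤ-solve

  point-suc : ∀ l r → point l r ℤ.+ + 1 ≡ point l (suc r)
  point-suc l r = shift (+ K) l (+ r)
    where
    shift : ∀ a l r → a ℤ.* l ℤ.+ r ℤ.+ + 1 ≡ a ℤ.* l ℤ.+ (+ 1 ℤ.+ r)
    shift = ℤ-solve

  point-at-K : ∀ l → point l K ≡ + K ℤ.* (l ℤ.+ + 1)
  point-at-K l = shift (+ K) l
    where
    shift : ∀ a l → a ℤ.* l ℤ.+ a ≡ a ℤ.* (l ℤ.+ + 1)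
    shift = ℤ-solve

  point-interior≢0 : ∀ l r → 1 ≤ r → r < K → point l r ≢ + 0
  point-interior≢0 l r 1≤r r<K point≡0 = excluded ∣ l ∣ refl
    where
    solve-r : ∀ a l r → r ≡ ℤ.- (a ℤ.* l) ℤ.+ (a ℤ.* l ℤ.+ r)
    solve-r = ℤ-solve
    r≡K∣l∣ : r ≡ K * ∣ l ∣
    r≡K∣l∣ = begin
        r
      ≡⟨ cong ∣_∣ (trans (solve-r (+ K) l (+ r)) (cong (λ x → ℤ.- (+ K ℤ.* l) ℤ.+ x) point≡0)) ⟩
        ∣ ℤ.- (+ K ℤ.* l) ℤ.+ + 0 ∣
      ≡⟨ cong ∣_∣ (ℤP.+-identityʳ (ℤ.- (+ K ℤ.* l))) ⟩
        ∣ ℤ.- (+ K ℤ.* l) ∣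
      ≡⟨ ℤP.∣-i∣≡∣i∣ (+ K ℤ.* l) ⟩
        ∣ + K ℤ.* l ∣
      ≡⟨ ℤP.abs-* (+ K) l ⟩
        K * ∣ l ∣ ∎
      where open ≡-Reasoning
    excluded : ∀ m → ∣ l ∣ ≡ m → ⊥
    excluded zero    ∣l∣≡0 = ℕP.<-irrefl (sym (trans r≡K∣l∣ (trans (cong (K *_) ∣l∣≡0) (ℕP.*-zeroʳ K)))) 1≤r
    excluded (suc m) ∣l∣≡m = ℕP.<-irrefl refl
      (ℕP.<-≤-trans r<K (subst (K ≤_) (sym (trans r≡K∣l∣ (cong (K *_) ∣l∣≡m))) (ℕP.m≤m*n K (suc m))))

  latticeWalks : ℕ → ℤ → ℕ
  latticeWalks s l = walks s (+ K ℤ.* l)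

  latticeWalks-neg : ∀ s l → latticeWalks s (ℤ.- l) ≡ latticeWalks s l
  latticeWalks-neg s l = trans (cong (walks s) (sym (ℤP.neg-distribʳ-* (+ K) l))) (walks-neg s (+ K ℤ.* l))

  -- Walks of length s ending at Kl + r (0 < r < K) whose last visit to Kℤ
  -- happens at time s-1-t: the visit is at Kl, followed by an excursion
  -- 1 → r inside the strip, or at K(l+1), followed by an excursion K-1 → r,
  -- counted by reflection as an excursion 1 → r′ with r′ = K - r.
  lastVisit : ℕ → ℤ → ℕ → ℕ → ℕ → ℕ
  lastVisit s l r r′ t =
    latticeWalks (s ∸ suc t) l * stripWalks t r + latticeWalks (s ∸ suc t) (l ℤ.+ + 1) * stripWalks t r′

  Decomposition : ℕ → Set
  Decomposition s = ∀ l r r′ → r + r′ ≡ K → 1 ≤ r → 1 ≤ r′ →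
    walks s (point l r) ≡ sumℕ s (lastVisit s l r r′)

  lastVisit-walls : ∀ s l a b t → stripWalks t a ≡ 0 → stripWalks t b ≡ 0 → lastVisit s l a b t ≡ 0
  lastVisit-walls s l a b t Sa≡0 Sb≡0 rewrite Sa≡0 | Sb≡0 =
    cong₂ _+_ (ℕP.*-zeroʳ (latticeWalks (s ∸ suc t) l)) (ℕP.*-zeroʳ (latticeWalks (s ∸ suc t) (l ℤ.+ + 1)))

  -- A walk whose last step comes from the left neighbour Kl + r of Kl + r + 1:
  -- for r = 0 that neighbour is the lattice point Kl itself.
  decomposition-left : ∀ s → Decomposition s → ∀ l r r′ → suc r + r′ ≡ K → 1 ≤ r′ →
    walks s (point l (suc r) - + 1) ≡
      latticeWalks s l * stripWalks 0 (suc r) + sumℕ s (lastVisit s l r (suc r′))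
  decomposition-left s _ l zero r′ e _ = begin
      walks s (point l 1 - + 1)
    ≡⟨ cong (walks s) (trans (point-pred l 0) (ℤP.+-identityʳ _)) ⟩
      latticeWalks s l
    ≡⟨ sym (ℕP.*-identityʳ _) ⟩
      latticeWalks s l * 1
    ≡⟨ sym (ℕP.+-identityʳ _) ⟩
      latticeWalks s l * 1 + 0
    ≡⟨ cong (λ x → latticeWalks s l * 1 + x) (sym (sumℕ-zero s _ (λ t → lastVisit-walls s l 0 (suc r′) t (stripWalks-at-0 t) (at-K t)))) ⟩
      latticeWalks s l * 1 + sumℕ s (lastVisit s l 0 (suc r′)) ∎
    where
    open ≡-Reasoning
    at-K : ∀ t → stripWalks t (suc r′) ≡ 0
    at-K t = trans (cong (stripWalks t) e) (stripWalks-at-K t)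
  decomposition-left s decomposition l (suc r) r′ e _ = begin
      walks s (point l (suc (suc r)) - + 1)
    ≡⟨ cong (walks s) (point-pred l (suc r)) ⟩
      walks s (point l (suc r))
    ≡⟨ decomposition l (suc r) (suc r′) (trans (ℕP.+-suc (suc r) r′) e) (s≤s z≤n) (s≤s z≤n) ⟩
      sumℕ s (lastVisit s l (suc r) (suc r′))
    ≡⟨ cong (_+ sumℕ s (lastVisit s l (suc r) (suc r′))) (sym (ℕP.*-zeroʳ (latticeWalks s l))) ⟩
      latticeWalks s l * 0 + sumℕ s (lastVisit s l (suc r) (suc r′)) ∎
    where open ≡-Reasoning

  -- A walk whose last step comes from the right neighbour Kl + r + 1 of Kl + r:
  -- for r + 1 = K that neighbour is the lattice point K(l+1).
  decomposition-right : ∀ s → Decomposition s → ∀ l r r′ → r + suc r′ ≡ K → 1 ≤ r →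
    walks s (point l r ℤ.+ + 1) ≡
      latticeWalks s (l ℤ.+ + 1) * stripWalks 0 (suc r′) + sumℕ s (lastVisit s l (suc r) r′)
  decomposition-right s _ l r zero e _ = begin
      walks s (point l r ℤ.+ + 1)
    ≡⟨ cong (walks s) (trans (point-suc l r) (trans (cong (point l) r+1≡K) (point-at-K l))) ⟩
      latticeWalks s (l ℤ.+ + 1)
    ≡⟨ sym (ℕP.*-identityʳ _) ⟩
      latticeWalks s (l ℤ.+ + 1) * 1
    ≡⟨ sym (ℕP.+-identityʳ _) ⟩
      latticeWalks s (l ℤ.+ + 1) * 1 + 0
    ≡⟨ cong (λ x → latticeWalks s (l ℤ.+ + 1) * 1 + x) (sym (sumℕ-zero s _ vanishes)) ⟩
      latticeWalks s (l ℤ.+ + 1) * 1 + sumℕ s (lastVisit s l (suc r) 0) ∎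
    where
    open ≡-Reasoning
    r+1≡K : suc r ≡ K
    r+1≡K = trans (ℕP.+-comm 1 r) e
    vanishes : ∀ t → lastVisit s l (suc r) 0 t ≡ 0
    vanishes t = lastVisit-walls s l (suc r) 0 t (trans (cong (stripWalks t) r+1≡K) (stripWalks-at-K t)) (stripWalks-at-0 t)
  decomposition-right s decomposition l r (suc r′) e _ = begin
      walks s (point l r ℤ.+ + 1)
    ≡⟨ cong (walks s) (point-suc l r) ⟩
      walks s (point l (suc r))
    ≡⟨ decomposition l (suc r) (suc r′) (trans (sym (ℕP.+-suc r (suc r′))) e) (s≤s z≤n) (s≤s z≤n) ⟩
      sumℕ s (lastVisit s l (suc r) (suc r′))
    ≡⟨ cong (_+ sumℕ s (lastVisit s l (suc r) (suc r′))) (sym (ℕP.*-zeroʳ (latticeWalks s (l ℤ.+ + 1)))) ⟩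
      latticeWalks s (l ℤ.+ + 1) * 0 + sumℕ s (lastVisit s l (suc r) (suc r′)) ∎
    where open ≡-Reasoning

  -- Proof of the decomposition by induction on the length: split off the last
  -- step, and note that an excursion of length t+1 ending at r comes from r-1
  -- or r+1 (stripWalks-step).
  decomposition : ∀ s → Decomposition s
  decomposition zero l r r′ e 1≤r 1≤r′ =
    walks-zero-off-origin (point l r) (point-interior≢0 l r 1≤r (below-K r r′ 1≤r′ e))
    where
    below-K : ∀ r r′ → 1 ≤ r′ → r + r′ ≡ K → r < K
    below-K r (suc r′) _ e = subst (r <_) e (ℕP.m<m+n r (s≤s z≤n))
  decomposition (suc s) l (suc r) (suc r′) e _ _ = begin
      walks s (point l (suc r) - + 1) + walks s (point l (suc r) ℤ.+ + 1)
    ≡⟨ cong₂ _+_ (decomposition-left s (decomposition s) l r (suc r′) e (s≤s z≤n))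
                 (decomposition-right s (decomposition s) l (suc r) r′ e (s≤s z≤n)) ⟩
      (a + A) + (b + B)
    ≡⟨ +-interchange a A b B ⟩
      (a + b) + (A + B)
    ≡⟨ cong (λ x → a + b + x) (sym (trans (sumℕ-cong s (λ t _ → excursion t)) (sumℕ-+ s _ _))) ⟩
      lastVisit (suc s) l (suc r) (suc r′) 0 + sumℕ s (λ t → lastVisit (suc s) l (suc r) (suc r′) (suc t))
    ≡⟨ sym (sumℕ-shift s (lastVisit (suc s) l (suc r) (suc r′))) ⟩
      sumℕ (suc s) (lastVisit (suc s) l (suc r) (suc r′)) ∎
    where
    open ≡-Reasoning
    a = latticeWalks s l * stripWalks 0 (suc r)
    b = latticeWalks s (l ℤ.+ + 1) * stripWalks 0 (suc r′)
    A = sumℕ s (lastVisit s l r (suc (suc r′)))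
    B = sumℕ s (lastVisit s l (suc (suc r)) r′)
    r<K : suc r < K
    r<K = subst (suc r <_) e (ℕP.m<m+n (suc r) (s≤s z≤n))
    r′<K : suc r′ < K
    r′<K = subst (suc r′ <_) (trans (ℕP.+-comm (suc r′) (suc r)) e) (ℕP.m<m+n (suc r′) (s≤s z≤n))
    regroup : ∀ h h′ a b c d → h * (a + b) + h′ * (c + d) ≡ (h * a + h′ * d) + (h * b + h′ * c)
    regroup = ℕ-solve
    excursion : ∀ t → lastVisit (suc s) l (suc r) (suc r′) (suc t) ≡
      lastVisit s l r (suc (suc r′)) t + lastVisit s l (suc (suc r)) r′ t
    excursion t rewrite stripWalks-step t r r<K | stripWalks-step t r′ r′<K =
      regroup (latticeWalks (s ∸ suc t) l) (latticeWalks (s ∸ suc t) (l ℤ.+ + 1))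
              (stripWalks t r) (stripWalks t (suc (suc r))) (stripWalks t r′) (stripWalks t (suc (suc r′)))

  shiftedWalks : ℕ → ℤ → ℤ → ℕ
  shiftedWalks s δ l = walks s (δ - + K ℤ.* l)

  -- The t-th term of the decomposition of symmetrised shifted walks at 0 < r ≤ k:
  -- weights of the excursions to r and to its mirror image K - r.
  pairTerm : ℕ → ℕ → ℕ → ℤ → ℕ
  pairTerm s r t l =
    2 * (stripWalks t r ∸ stripWalks t (K ∸ r)) * latticeWalks (s ∸ suc t) l +
    stripWalks t (K ∸ r) * pascalStep (latticeWalks (s ∸ suc t)) l

  -- Adding the decompositions at Kl + r and at -Kl + r, the reflection
  -- inequality turns the sum into nonnegative multiples of lattice walk counts
  -- and of their Pascal steps.
  pair-decomposition : ∀ s r → 1 ≤ r → r ≤ k → ∀ l →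
    symmetrize (shiftedWalks s (+ r)) l ≡ sumℕ s (λ t → pairTerm s r t l)
  pair-decomposition s r 1≤r r≤k l = begin
      walks s (+ r - + K ℤ.* l) + walks s (+ r - + K ℤ.* (ℤ.- l))
    ≡⟨ cong₂ _+_ (cong (walks s) (mirrored (+ r) (+ K) l)) (cong (walks s) (direct (+ r) (+ K) l)) ⟩
      walks s (point (ℤ.- l) r) + walks s (point l r)
    ≡⟨ cong₂ _+_ (decomposition s (ℤ.- l) r r′ r+r′≡K 1≤r 1≤r′)
                 (decomposition s l r r′ r+r′≡K 1≤r 1≤r′) ⟩
      sumℕ s (lastVisit s (ℤ.- l) r r′) + sumℕ s (lastVisit s l r r′)
    ≡⟨ sumℕ-+ s _ _ ⟨
      sumℕ s (λ t → lastVisit s (ℤ.- l) r r′ t + lastVisit s l r r′ t)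
    ≡⟨ sumℕ-cong s (λ t _ → combine t) ⟩
      sumℕ s (λ t → pairTerm s r t l) ∎
    where
    open ≡-Reasoning
    r′ = K ∸ r
    r<K : r < K
    r<K = ℕP.≤-trans (s≤s r≤k) (s≤s (ℕP.m≤n+m k k′))
    r+r′≡K : r + r′ ≡ K
    r+r′≡K = ℕP.m+[n∸m]≡n (ℕP.<⇒≤ r<K)
    1≤r′ : 1 ≤ r′
    1≤r′ = ℕP.m<n⇒0<n∸m r<K
    mirrored : ∀ r a l → r - a ℤ.* l ≡ a ℤ.* (ℤ.- l) ℤ.+ r
    mirrored = ℤ-solve
    direct : ∀ r a l → r - a ℤ.* (ℤ.- l) ≡ a ℤ.* l ℤ.+ r
    direct = ℤ-solve
    neg-pred : ∀ l → ℤ.- l ℤ.+ + 1 ≡ ℤ.- (l - + 1)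
    neg-pred = ℤ-solve
    regroup : ∀ h hm hp d x → (h * (d + x) + hm * x) + (h * (d + x) + hp * x) ≡ 2 * d * h + x * (2 * h + (hm + hp))
    regroup = ℕ-solve
    combine : ∀ t → lastVisit s (ℤ.- l) r r′ t + lastVisit s l r r′ t ≡ pairTerm s r t l
    combine t = begin
        (H (ℤ.- l) * a + H (ℤ.- l ℤ.+ + 1) * b) + (H l * a + H (l ℤ.+ + 1) * b)
      ≡⟨ cong₂ (λ x y → (x * a + y * b) + (H l * a + H (l ℤ.+ + 1) * b))
               (latticeWalks-neg (s ∸ suc t) l) (trans (cong H (neg-pred l)) (latticeWalks-neg (s ∸ suc t) (l - + 1))) ⟩
        (H l * a + H (l - + 1) * b) + (H l * a + H (l ℤ.+ + 1) * b)
      ≡⟨ cong (λ x → (H l * x + H (l - + 1) * b) + (H l * x + H (l ℤ.+ + 1) * b)) (sym (ℕP.m∸n+n≡m b≤a)) ⟩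
        (H l * (a ∸ b + b) + H (l - + 1) * b) + (H l * (a ∸ b + b) + H (l ℤ.+ + 1) * b)
      ≡⟨ regroup (H l) (H (l - + 1)) (H (l ℤ.+ + 1)) (a ∸ b) b ⟩
        pairTerm s r t l ∎
      where
      H = latticeWalks (s ∸ suc t)
      a = stripWalks t r
      b = stripWalks t r′
      b≤a : b ≤ a
      b≤a = stripWalks-reflection t r′ r (trans (ℕP.+-comm r′ r) r+r′≡K) r≤k

  s∸[1+t]<s : ∀ {s t} → t < s → s ∸ suc t < s
  s∸[1+t]<s t<s = ℕP.∸-monoʳ-< (s≤s z≤n) t<s

  pairs-cone-from : ∀ s → (∀ {t} → t < s → RowCone t (latticeWalks t)) →
    ∀ r → 1 ≤ r → r ≤ k → RowCone s (symmetrize (shiftedWalks s (+ r)))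
  pairs-cone-from s cones r 1≤r r≤k =
    cone-ext (λ l → sym (pair-decomposition s r 1≤r r≤k l)) (cone-sum s (pairTerm s r) term-cone)
    where
    term-cone : ∀ t → t < s → RowCone s (pairTerm s r t)
    term-cone t t<s = cone-+
      (cone-* (2 * (stripWalks t r ∸ stripWalks t (K ∸ r))) (cone-mono (ℕP.<⇒≤ shorter) (cones shorter)))
      (cone-* (stripWalks t (K ∸ r)) (cone-mono shorter (cone-step (cones shorter))))
      where
      shorter : s ∸ suc t < s
      shorter = s∸[1+t]<s t<s

  -- Walks to the lattice Kℤ lie in the cone: the first step leads to ±1, so
  -- latticeWalks (s+1) is the symmetrisation of shiftedWalks s 1.
  latticeWalks-cone : ∀ s → RowCone s (latticeWalks s)
  latticeWalks-cone = <-rec (λ s → RowCone s (latticeWalks s)) step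
    where
    row-0 : ∀ l → row 0 l ≡ latticeWalks 0 l
    row-0 (+ zero) rewrite ℤP.*-zeroʳ (+ K) = refl
    row-0 (+ suc _) = refl
    row-0 -[1+ _ ]  = refl
    neg-pred : ∀ a l → + 1 - a ℤ.* l ≡ ℤ.- (a ℤ.* l - + 1)
    neg-pred = ℤ-solve
    succ : ∀ a l → + 1 - a ℤ.* (ℤ.- l) ≡ a ℤ.* l ℤ.+ + 1
    succ = ℤ-solve
    first-step : ∀ s l → symmetrize (shiftedWalks s (+ 1)) l ≡ latticeWalks (suc s) l
    first-step s l = cong₂ _+_ (trans (cong (walks s) (neg-pred (+ K) l)) (walks-neg s _))
                               (cong (walks s) (succ (+ K) l))
    step : ∀ s → (∀ {t} → t < s → RowCone t (latticeWalks t)) → RowCone s (latticeWalks s)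
    step zero    _     = cone-ext row-0 (cone-row 0 z≤n)
    step (suc s) cones = cone-ext (first-step s)
      (cone-mono (ℕP.n≤1+n s) (pairs-cone-from s (λ t<s → cones (ℕP.m<n⇒m<1+n t<s)) 1 ℕP.≤-refl (s≤s z≤n)))

  shiftedWalks-neg : ∀ s δ l → shiftedWalks s (ℤ.- δ) l ≡ shiftedWalks s δ (ℤ.- l)
  shiftedWalks-neg s δ l = trans (cong (walks s) (negate δ (+ K) l)) (walks-neg s _)
    where
    negate : ∀ δ a l → ℤ.- δ - a ℤ.* l ≡ ℤ.- (δ - a ℤ.* (ℤ.- l))
    negate = ℤ-solve

  pairs-cone : ∀ s δ → ∣ δ ∣ ≤ k → RowCone s (symmetrize (shiftedWalks s δ))
  pairs-cone s (+ zero) _ = cone-ext doubled (cone-* 2 (latticeWalks-cone s))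
    where
    centred : ∀ l → shiftedWalks s (+ 0) l ≡ latticeWalks s l
    centred l = trans (cong (walks s) (ℤP.+-identityˡ (ℤ.- (+ K ℤ.* l)))) (walks-neg s (+ K ℤ.* l))
    doubled : ∀ l → 2 * latticeWalks s l ≡ symmetrize (shiftedWalks s (+ 0)) l
    doubled l = begin
        latticeWalks s l + (latticeWalks s l + 0)
      ≡⟨ cong (λ x → latticeWalks s l + x) (ℕP.+-identityʳ _) ⟩
        latticeWalks s l + latticeWalks s l
      ≡⟨ cong₂ _+_ (sym (centred l)) (trans (sym (latticeWalks-neg s l)) (sym (centred (ℤ.- l)))) ⟩
        shiftedWalks s (+ 0) l + shiftedWalks s (+ 0) (ℤ.- l) ∎
      where open ≡-Reasoning
  pairs-cone s (+ suc r) r<k = pairs-cone-from s (λ {t} _ → latticeWalks-cone t) (suc r) (s≤s z≤n) r<k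
  pairs-cone s -[1+ r ] r<k = cone-ext reflected (pairs-cone s (+ suc r) r<k)
    where
    reflected : ∀ l → symmetrize (shiftedWalks s (+ suc r)) l ≡ symmetrize (shiftedWalks s -[1+ r ]) l
    reflected l = begin
        shiftedWalks s (+ suc r) l + shiftedWalks s (+ suc r) (ℤ.- l)
      ≡⟨ ℕP.+-comm (shiftedWalks s (+ suc r) l) (shiftedWalks s (+ suc r) (ℤ.- l)) ⟩
        shiftedWalks s (+ suc r) (ℤ.- l) + shiftedWalks s (+ suc r) l
      ≡⟨ cong₂ _+_ (sym (shiftedWalks-neg s (+ suc r) l))
                   (trans (cong (shiftedWalks s (+ suc r)) (sym (ℤP.neg-involutive l)))
                          (sym (shiftedWalks-neg s (+ suc r) (ℤ.- l)))) ⟩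
        shiftedWalks s -[1+ r ] l + shiftedWalks s -[1+ r ] (ℤ.- l) ∎
      where open ≡-Reasoning

  -- Combining the shifted-walk cones with the nonnegative weights
  -- C(n,i) walks_{n-i}(v) of the product formula.
  crossWalks-cone : ∀ n δ v → ∣ δ ∣ ≤ k → RowCone n (symmetrize (λ l → crossWalks n (δ - + K ℤ.* l) v))
  crossWalks-cone n δ v δ≤k = cone-ext combined (cone-sum (suc n) term term-cone)
    where
    weight : ℕ → ℕ
    weight i = (n C i) * walks (n ∸ i) v
    term : ℕ → ℤ → ℕ
    term i l = weight i * symmetrize (shiftedWalks i δ) l
    term-cone : ∀ i → i < suc n → RowCone n (term i)
    term-cone i i<1+n = cone-* (weight i) (cone-mono (ℕP.≤-pred i<1+n) (pairs-cone i δ δ≤k))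
    distrib : ∀ c w a b → (c * w) * (a + b) ≡ c * (a * w) + c * (b * w)
    distrib = ℕ-solve
    combined : ∀ l → sumℕ (suc n) (λ i → term i l) ≡ symmetrize (λ l → crossWalks n (δ - + K ℤ.* l) v) l
    combined l = trans
      (sumℕ-cong (suc n) (λ i _ → distrib (n C i) (walks (n ∸ i) v) (shiftedWalks i δ l) (shiftedWalks i δ (ℤ.- l))))
      (sumℕ-+ (suc n) _ _)

  squares products : ℕ → ℕ → ℤ → ℕ
  squares  M N l = binomℤ (M + N) (+ M - (+ k ℤ.* l)) * binomℤ (M + N) (+ M - (+ k ℤ.* l))
  products M N l = binomℤ (M + N) (+ M - (+ k ℤ.* l)) * binomℤ (M + N) (+ N - (+ k ℤ.* l))

  -- (i): with u = (M - N) - Kl and v = 0.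
  squares-cone : ∀ M N → distℕ M N ≤ k → RowCone (M + N) (symmetrize (squares M N))
  squares-cone M N dist≤k = cone-ext (λ l → sym (cong₂ _+_ (as-crossWalks l) (as-crossWalks (ℤ.- l))))
    (crossWalks-cone (M + N) (+ M - + N) (+ 0) dist≤k)
    where
    first : ∀ M N k l → (M - k ℤ.* l) ℤ.+ (M - k ℤ.* l) - (M ℤ.+ N) ≡ ((M - N) - (k ℤ.+ k) ℤ.* l) ℤ.+ + 0
    first = ℤ-solve
    second : ∀ M N k l → (M - k ℤ.* l) ℤ.+ (M - k ℤ.* l) - (M ℤ.+ N) ≡ ((M - N) - (k ℤ.+ k) ℤ.* l) - + 0
    second = ℤ-solve
    as-crossWalks : ∀ l → squares M N l ≡ crossWalks (M + N) ((+ M - + N) - + K ℤ.* l) (+ 0)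
    as-crossWalks l = binomProduct≡crossWalks (M + N) x x _ _ (first (+ M) (+ N) (+ k) l) (second (+ M) (+ N) (+ k) l)
      where x = + M - + k ℤ.* l

  -- (ii): with u = -Kl and v = M - N.
  products-cone : ∀ M N → RowCone (M + N) (symmetrize (products M N))
  products-cone M N = cone-ext (λ l → sym (cong₂ _+_ (as-crossWalks l) (as-crossWalks (ℤ.- l))))
    (crossWalks-cone (M + N) (+ 0) (+ M - + N) z≤n)
    where
    first : ∀ M N k l → (M - k ℤ.* l) ℤ.+ (M - k ℤ.* l) - (M ℤ.+ N) ≡ (+ 0 - (k ℤ.+ k) ℤ.* l) ℤ.+ (M - N)
    first = ℤ-solve
    second : ∀ M N k l → (N - k ℤ.* l) ℤ.+ (N - k ℤ.* l) - (M ℤ.+ N) ≡ (+ 0 - (k ℤ.+ k) ℤ.* l) - (M - N)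
    second = ℤ-solve
    as-crossWalks : ∀ l → products M N l ≡ crossWalks (M + N) (+ 0 - + K ℤ.* l) (+ M - + N)
    as-crossWalks l = binomProduct≡crossWalks (M + N) (+ M - + k ℤ.* l) (+ N - + k ℤ.* l) _ _
                        (first (+ M) (+ N) (+ k) l) (second (+ M) (+ N) (+ k) l)

module OrderedRingSums {c ℓ₁ ℓ₂} (R : OrderedCommutativeRing c ℓ₁ ℓ₂) where
  open OrderedCommutativeRing R public
    using (Carrier; _≈_; isTotalOrder; +-mono-≤; +-commutativeMonoid; +-commutativeSemigroup)
    renaming (0# to 𝟘; _+_ to _⊕_; _≤_ to _≼_; +-identityˡ to ⊕-identityˡ; +-identityʳ to ⊕-identityʳ;
              +-comm to ⊕-comm; +-assoc to ⊕-assoc; +-cong to ⊕-cong;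
              refl to ≈-refl; sym to ≈-sym; trans to ≈-trans; reflexive to ≡⇒≈)
  open IsTotalOrder isTotalOrder public using () renaming (trans to ≼-trans; reflexive to ≼-reflexive)
  open import Algebra.Properties.CommutativeMonoid.Mult +-commutativeMonoid
    using (×-homo-+; ×-assocˡ; ×-distrib-+) renaming (_×_ to _×ᴿ_)
  open import Algebra.Properties.CommutativeSemigroup +-commutativeSemigroup
    using () renaming (interchange to ⊕-interchange)
  open import Relation.Binary.Reasoning.Setoid (OrderedCommutativeRing.setoid R) public

  infixr 8 _·ᴿ_
  _·ᴿ_ : ℕ → Carrier → Carrier
  _·ᴿ_ = _·_ R

  sum : ℕ → (ℕ → Carrier) → Carrier
  sum = sumTo R

  ·≡× : ∀ n x → n ·ᴿ x ≡ n ×ᴿ x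
  ·≡× zero    x = refl
  ·≡× (suc n) x = cong (x ⊕_) (·≡× n x)

  ·-homo-+ : ∀ m n x → (m + n) ·ᴿ x ≈ m ·ᴿ x ⊕ n ·ᴿ x
  ·-homo-+ m n x rewrite ·≡× (m + n) x | ·≡× m x | ·≡× n x = ×-homo-+ x m n

  ·-distrib-⊕ : ∀ n x y → n ·ᴿ (x ⊕ y) ≈ n ·ᴿ x ⊕ n ·ᴿ y
  ·-distrib-⊕ n x y rewrite ·≡× n (x ⊕ y) | ·≡× n x | ·≡× n y = ×-distrib-+ x y n

  ·-assoc : ∀ m n x → (m * n) ·ᴿ x ≈ m ·ᴿ (n ·ᴿ x)
  ·-assoc m n x rewrite ·≡× (m * n) x | ·≡× n x | ·≡× m (n ×ᴿ x) = ≈-sym (×-assocˡ x m n)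

  ·-zeroʳ : ∀ n → n ·ᴿ 𝟘 ≈ 𝟘
  ·-zeroʳ zero    = ≈-refl
  ·-zeroʳ (suc n) = ≈-trans (⊕-identityˡ _) (·-zeroʳ n)

  nonneg-resp-≈ : ∀ {x y} → 𝟘 ≼ x → x ≈ y → 𝟘 ≼ y
  nonneg-resp-≈ 0≼x x≈y = ≼-trans 0≼x (≼-reflexive x≈y)

  nonneg-⊕ : ∀ {x y} → 𝟘 ≼ x → 𝟘 ≼ y → 𝟘 ≼ (x ⊕ y)
  nonneg-⊕ {x} {y} 0≼x 0≼y = ≼-trans 0≼y (≼-trans (≼-reflexive (≈-sym (⊕-identityˡ y))) (+-mono-≤ y 0≼x))

  nonneg-· : ∀ n {x} → 𝟘 ≼ x → 𝟘 ≼ (n ·ᴿ x)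
  nonneg-· zero    0≼x = ≼-reflexive ≈-refl
  nonneg-· (suc n) 0≼x = nonneg-⊕ 0≼x (nonneg-· n 0≼x)

  sum-cong : ∀ n {f g} → (∀ i → i < n → f i ≈ g i) → sum n f ≈ sum n g
  sum-cong zero    f≈g = ≈-refl
  sum-cong (suc n) f≈g = ⊕-cong (sum-cong n (λ i i<n → f≈g i (ℕP.m<n⇒m<1+n i<n))) (f≈g n (ℕP.n<1+n n))

  sum-⊕ : ∀ n f g → sum n (λ i → f i ⊕ g i) ≈ sum n f ⊕ sum n g
  sum-⊕ zero    f g = ≈-sym (⊕-identityˡ 𝟘)
  sum-⊕ (suc n) f g = ≈-trans (⊕-cong (sum-⊕ n f g) ≈-refl) (⊕-interchange (sum n f) (sum n g) (f n) (g n))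

  sum-· : ∀ n m f → sum n (λ i → m ·ᴿ f i) ≈ m ·ᴿ sum n f
  sum-· zero    m f = ≈-sym (·-zeroʳ m)
  sum-· (suc n) m f = ≈-trans (⊕-cong (sum-· n m f) ≈-refl) (≈-sym (·-distrib-⊕ m (sum n f) (f n)))

  sum-zero : ∀ n f → (∀ i → i < n → f i ≈ 𝟘) → sum n f ≈ 𝟘
  sum-zero zero    f f≈0 = ≈-refl
  sum-zero (suc n) f f≈0 =
    ≈-trans (⊕-cong (sum-zero n f (λ i i<n → f≈0 i (ℕP.m<n⇒m<1+n i<n))) (f≈0 n (ℕP.n<1+n n))) (⊕-identityˡ 𝟘)

  sum-shift : ∀ n f → sum (suc n) f ≈ f 0 ⊕ sum n (λ i → f (suc i))
  sum-shift zero    f = ⊕-comm 𝟘 (f 0)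
  sum-shift (suc n) f = ≈-trans (⊕-cong (sum-shift n f) ≈-refl) (⊕-assoc (f 0) _ _)

  sum-truncate : ∀ {m n} f → n ≤ m → (∀ i → n ≤ i → f i ≈ 𝟘) → sum m f ≈ sum n f
  sum-truncate {zero}  f z≤n _ = ≈-refl
  sum-truncate {suc m} f n≤1+m f≈0 with ℕP.m≤n⇒m<n∨m≡n n≤1+m
  ... | inj₂ refl  = ≈-refl
  ... | inj₁ n<1+m = ≈-trans (⊕-cong (sum-truncate f n≤m f≈0) (f≈0 m n≤m)) (⊕-identityʳ _)
    where
    n≤m : _ ≤ m
    n≤m = ℕP.≤-pred n<1+m

  sum-reverse : ∀ m f → sum m f ≈ sum m (λ r → f (m ∸ suc r))
  sum-reverse zero    f = ≈-refl
  sum-reverse (suc m) f = begin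
      sum m f ⊕ f m
    ≈⟨ ⊕-cong (sum-reverse m f) ≈-refl ⟩
      sum m (λ r → f (m ∸ suc r)) ⊕ f m
    ≈⟨ ⊕-comm _ _ ⟩
      f (m ∸ 0) ⊕ sum m (λ r → f (m ∸ suc r))
    ≈⟨ sum-shift m (λ r → f (m ∸ r)) ⟨
      sum (suc m) (λ r → f (suc m ∸ suc r)) ∎

  sumSym-split : ∀ L (f : ℤ → Carrier) → sumSym R L f ≈ f (+ 0) ⊕ sum L (λ j → f (+ suc j) ⊕ f -[1+ j ])
  sumSym-split zero    f = ⊕-comm 𝟘 (f (+ 0))
  sumSym-split (suc L) f = begin
      sum (suc (2 * suc L)) g
    ≡⟨ cong (λ n → sum n g) (length L) ⟩
      sum (suc (suc (2 * L))) g ⊕ g (suc (suc (2 * L)))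
    ≈⟨ ⊕-cong (sum-shift (suc (2 * L)) g) ≈-refl ⟩
      (g 0 ⊕ sum (suc (2 * L)) (λ i → g (suc i))) ⊕ g (suc (suc (2 * L)))
    ≈⟨ ⊕-cong (⊕-cong ≈-refl (≈-trans (sum-cong (suc (2 * L)) (λ i _ → ≡⇒≈ (cong f (recentre (+ i) (+ L)))))
                                      (sumSym-split L f))) ≈-refl ⟩
      (g 0 ⊕ (f (+ 0) ⊕ sum L pair)) ⊕ g (suc (suc (2 * L)))
    ≈⟨ rearrange (g 0) (f (+ 0)) (sum L pair) (g (suc (suc (2 * L)))) ⟩
      f (+ 0) ⊕ (sum L pair ⊕ (g (suc (suc (2 * L))) ⊕ g 0))
    ≡⟨ cong (λ z → f (+ 0) ⊕ (sum L pair ⊕ (f z ⊕ g 0))) (top (+ L)) ⟩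
      f (+ 0) ⊕ sum (suc L) pair ∎
    where
    g : ℕ → Carrier
    g i = f (+ i - + suc L)
    pair : ℕ → Carrier
    pair j = f (+ suc j) ⊕ f -[1+ j ]
    length : ∀ L → suc (2 * suc L) ≡ suc (suc (suc (2 * L)))
    length = ℕ-solve
    recentre : ∀ i l → (+ 1 ℤ.+ i) - (+ 1 ℤ.+ l) ≡ i - l
    recentre = ℤ-solve
    top : ∀ l → (+ 1 ℤ.+ (+ 1 ℤ.+ (l ℤ.+ (l ℤ.+ + 0)))) - (+ 1 ℤ.+ l) ≡ + 1 ℤ.+ l
    top = ℤ-solve
    rearrange : ∀ a b c d → (a ⊕ (b ⊕ c)) ⊕ d ≈ b ⊕ (c ⊕ (d ⊕ a))
    rearrange a b c d = begin
      (a ⊕ (b ⊕ c)) ⊕ d   ≈⟨ ⊕-cong (⊕-comm a (b ⊕ c)) ≈-refl ⟩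
      ((b ⊕ c) ⊕ a) ⊕ d   ≈⟨ ⊕-assoc (b ⊕ c) a d ⟩
      (b ⊕ c) ⊕ (a ⊕ d)   ≈⟨ ⊕-assoc b c (a ⊕ d) ⟩
      b ⊕ (c ⊕ (a ⊕ d))   ≈⟨ ⊕-cong ≈-refl (⊕-cong ≈-refl (⊕-comm a d)) ⟩
      b ⊕ (c ⊕ (d ⊕ a))   ∎

module Positivity {c ℓ₁ ℓ₂} (R : OrderedCommutativeRing c ℓ₁ ℓ₂)
  (w : ℕ → ℕ → OrderedCommutativeRing.Carrier R) (p′ : ℕ) (hyp : Hyp R w) where
  open OrderedRingSums R

  p : ℕ
  p = suc p′

  coeff : ℕ → Carrier
  coeff l = polyCoeff R w l p

  coeff-high : ∀ l → p ≤ l → coeff l ≡ w l p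
  coeff-high l p≤l with p ℕ.≤ᵇ l | ℕP.≤⇒≤ᵇ p≤l
  ... | true | _ = refl

  coeff-low : ∀ l → ¬ (p ≤ l) → coeff l ≡ 𝟘
  coeff-low l p≰l with p ℕ.≤ᵇ l | ℕP.≤ᵇ⇒≤ p l
  ... | false | _      = refl
  ... | true  | T⇒p≤l = ⊥-elim (p≰l (T⇒p≤l _))

  -- Φ L g = Σ_{0<j≤L} g(j) · coeff j.  For g = symmetrize a this is the
  -- z^p-coefficient of Σ_{|l|≤L} a(l) p_{|l|}(z), since coeff 0 = 0.
  Φ : ℕ → (ℤ → ℕ) → Carrier
  Φ L g = sum L (λ j → g (+ suc j) ·ᴿ coeff (suc j))

  row-beyond : ∀ m i → m < i → row m (+ i) ≡ 0
  row-beyond m i m<i = k>n⇒nCk≡0 (ℕP.+-monoʳ-< m m<i)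

  -- For m < p every term of Φ (row m) vanishes: either C(2m, m+j) = 0 or j < p.
  Φ-row-small : ∀ m L → m < p → Φ L (row m) ≈ 𝟘
  Φ-row-small m L m<p = sum-zero L _ vanishes
    where
    vanishes : ∀ j → j < L → row m (+ suc j) ·ᴿ coeff (suc j) ≈ 𝟘
    vanishes j _ with p ℕ.≤? suc j
    ... | yes p≤j+1 rewrite row-beyond m (suc j) (ℕP.<-≤-trans m<p p≤j+1) = ≈-refl
    ... | no  p≰j+1 rewrite coeff-low (suc j) p≰j+1 = ·-zeroʳ (row m (+ suc j))

  -- For p ≤ m ≤ L, reversing the summation (j = m - r) and using
  -- C(2m, 2m - r) = C(2m, r) turns Φ (row m) into the sum of the hypothesis.
  Φ-row-large : ∀ m L → p ≤ m → m ≤ L →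
    Φ L (row m) ≈ sumTo R (suc (m ∸ p)) (λ r → ((2 * m) C r) ·ᴿ w (m ∸ r) p)
  Φ-row-large m L p≤m m≤L = begin
      sum L F
    ≈⟨ sum-truncate F m≤L beyond-row ⟩
      sum m F
    ≈⟨ sum-reverse m F ⟩
      sum m (λ r → F (m ∸ suc r))
    ≈⟨ sum-cong m reflected ⟩
      sum m G
    ≈⟨ sum-truncate G (ℕP.∸-monoʳ-< (s≤s z≤n) p≤m) beyond-top ⟩
      sum (suc (m ∸ p)) G
    ≈⟨ sum-cong (suc (m ∸ p)) within-top ⟩
      sumTo R (suc (m ∸ p)) (λ r → ((2 * m) C r) ·ᴿ w (m ∸ r) p) ∎
    where
    F G : ℕ → Carrier
    F j = row m (+ suc j) ·ᴿ coeff (suc j)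
    G r = ((2 * m) C r) ·ᴿ coeff (m ∸ r)
    reflected : ∀ r → r < m → F (m ∸ suc r) ≈ G r
    reflected r r<m = begin
        ((m + m) C (m + suc (m ∸ suc r))) ·ᴿ coeff (suc (m ∸ suc r))
      ≡⟨ cong (λ i → ((m + m) C (m + i)) ·ᴿ coeff i) (sym (ℕP.+-∸-assoc 1 r<m)) ⟩
        ((m + m) C (m + (m ∸ r))) ·ᴿ coeff (m ∸ r)
      ≡⟨ cong (λ i → ((m + m) C i) ·ᴿ coeff (m ∸ r)) (sym (ℕP.+-∸-assoc m (ℕP.<⇒≤ r<m))) ⟩
        ((m + m) C ((m + m) ∸ r)) ·ᴿ coeff (m ∸ r)
      ≡⟨ cong (_·ᴿ coeff (m ∸ r)) (sym (nCk≡nC[n∸k] (ℕP.≤-trans (ℕP.<⇒≤ r<m) (ℕP.m≤m+n m m)))) ⟩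
        ((m + m) C r) ·ᴿ coeff (m ∸ r)
      ≡⟨ cong (λ n → (n C r) ·ᴿ coeff (m ∸ r)) (cong (λ x → m + x) (sym (ℕP.+-identityʳ m))) ⟩
        G r ∎
    top : ∀ r → r ≤ m ∸ p → p ≤ m ∸ r
    top r r≤m∸p = ℕP.m+n≤o⇒m≤o∸n p (subst (_≤ m) (ℕP.+-comm r p) (ℕP.m≤o∸n⇒m+n≤o r p≤m r≤m∸p))
    bottom : ∀ r → p ≤ m ∸ r → r ≤ m ∸ p
    bottom r p≤m∸r with r ℕ.≤? m
    ... | yes r≤m = ℕP.m+n≤o⇒m≤o∸n r (subst (_≤ m) (ℕP.+-comm p r) (ℕP.m≤o∸n⇒m+n≤o p r≤m p≤m∸r))
    ... | no  r≰m = ⊥-elim (ℕP.n≮0 (ℕP.≤-trans p≤m∸r (ℕP.≤-reflexive m∸r≡0)))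
      where
      m∸r≡0 : m ∸ r ≡ 0
      m∸r≡0 = ℕP.m≤n⇒m∸n≡0 (ℕP.<⇒≤ (ℕP.≰⇒> r≰m))
    beyond-row : ∀ j → m ≤ j → F j ≈ 𝟘
    beyond-row j m≤j = ≡⇒≈ (cong (_·ᴿ coeff (suc j)) (row-beyond m (suc j) (s≤s m≤j)))
    within-top : ∀ r → r < suc (m ∸ p) → G r ≈ ((2 * m) C r) ·ᴿ w (m ∸ r) p
    within-top r r≤m∸p = ≡⇒≈ (cong (((2 * m) C r) ·ᴿ_) (coeff-high (m ∸ r) (top r (ℕP.≤-pred r≤m∸p))))
    beyond-top : ∀ r → suc (m ∸ p) ≤ r → G r ≈ 𝟘
    beyond-top r m∸p<r rewrite coeff-low (m ∸ r) (λ p≤m∸r → ℕP.<⇒≱ m∸p<r (bottom r p≤m∸r)) =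
      ·-zeroʳ ((2 * m) C r)

  Φ-row-nonneg : ∀ m L → m ≤ L → 𝟘 ≼ Φ L (row m)
  Φ-row-nonneg m L m≤L with p ℕ.≤? m
  ... | no  p≰m = ≼-reflexive (≈-sym (Φ-row-small m L (ℕP.≰⇒> p≰m)))
  ... | yes p≤m = nonneg-resp-≈ (hyp m p (s≤s z≤n) p≤m) (≈-sym (Φ-row-large m L p≤m m≤L))

  -- Φ L is additive and ℕ-homogeneous, hence nonnegative on the whole cone.
  Φ-cone-nonneg : ∀ {L g} → RowCone L g → 𝟘 ≼ Φ L g
  Φ-cone-nonneg {L} (cone-row m m≤L) = Φ-row-nonneg m L m≤L
  Φ-cone-nonneg {L} (cone-+ {f} {g} cf cg) = nonneg-resp-≈ (nonneg-⊕ (Φ-cone-nonneg cf) (Φ-cone-nonneg cg))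
    (≈-sym (≈-trans (sum-cong L (λ j _ → ·-homo-+ (f (+ suc j)) (g (+ suc j)) (coeff (suc j)))) (sum-⊕ L _ _)))
  Φ-cone-nonneg {L} (cone-* {f} n cf) = nonneg-resp-≈ (nonneg-· n (Φ-cone-nonneg cf))
    (≈-sym (≈-trans (sum-cong L (λ j _ → ·-assoc n (f (+ suc j)) (coeff (suc j)))) (sum-· L n _)))
  Φ-cone-nonneg {L} (cone-ext {f} {g} f≡g cf) = nonneg-resp-≈ (Φ-cone-nonneg cf)
    (sum-cong L (λ j _ → ≡⇒≈ (cong (_·ᴿ coeff (suc j)) (f≡g (+ suc j)))))

  seriesCoeff≈Φ : ∀ n a → seriesCoeff R w n a p ≈ Φ n (symmetrize a)
  seriesCoeff≈Φ n a = begin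
      sumSym R n f
    ≈⟨ sumSym-split n f ⟩
      a (+ 0) ·ᴿ 𝟘 ⊕ sum n (λ j → f (+ suc j) ⊕ f -[1+ j ])
    ≈⟨ ⊕-cong (·-zeroʳ (a (+ 0))) (sum-cong n (λ j _ → ≈-sym (·-homo-+ (a (+ suc j)) (a -[1+ j ]) (coeff (suc j))))) ⟩
      𝟘 ⊕ Φ n (symmetrize a)
    ≈⟨ ⊕-identityˡ _ ⟩
      Φ n (symmetrize a) ∎
    where
    f : ℤ → Carrier
    f l = a l ·ᴿ coeff ∣ l ∣

  coefficient-nonneg : ∀ n a → RowCone n (symmetrize a) → 𝟘 ≼ seriesCoeff R w n a p
  coefficient-nonneg n a cone = nonneg-resp-≈ (Φ-cone-nonneg cone) (≈-sym (seriesCoeff≈Φ n a))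

theorem3p1 : ∀ {c ℓ₁ ℓ₂} (R : OrderedCommutativeRing c ℓ₁ ℓ₂)
    (k : ℕ) → 1 ≤ k → (w : ℕ → ℕ → OrderedCommutativeRing.Carrier R) →
    Hyp R w →
    (∀ M N → distℕ M N ≤ k → ∀ p → 1 ≤ p →
      _≤R_ R (0# R) (seriesCoeff R w (M + N)
        (λ l → binomℤ (M + N) (+ M - (+ k Data.Integer.* l)) * binomℤ (M + N) (+ M - (+ k Data.Integer.* l))) p))
    ×
    (∀ M N → ∀ p → 1 ≤ p →
      _≤R_ R (0# R) (seriesCoeff R w (M + N)
        (λ l → binomℤ (M + N) (+ M - (+ k Data.Integer.* l)) * binomℤ (M + N) (+ N - (+ k Data.Integer.* l))) p))
theorem3p1 R zero () w hyp
theorem3p1 R (suc k′) _ w hyp = part-i , part-ii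
  where
  open Strip k′ using (squares; products; squares-cone; products-cone)
  part-i : ∀ M N → distℕ M N ≤ suc k′ → ∀ p → 1 ≤ p →
    _≤R_ R (0# R) (seriesCoeff R w (M + N) (squares M N) p)
  part-i M N dist≤k (suc p′) _ =
    Positivity.coefficient-nonneg R w p′ hyp (M + N) (squares M N) (squares-cone M N dist≤k)
  part-ii : ∀ M N → ∀ p → 1 ≤ p →
    _≤R_ R (0# R) (seriesCoeff R w (M + N) (products M N) p)
  part-ii M N (suc p′) _ =
    Positivity.coefficient-nonneg R w p′ hyp (M + N) (products M N) (products-cone M N)
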